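{- Fix an ATM signature $\Sigma$. If $\Gamma \vdash_{\mathrm{atm}} c : \rho$ and $c \to c'$, then $\Gamma \vdash_{\mathrm{atm}} c' : \rho$.
   Context: Syntax. Values $v ::= x \mid () \mid \mathtt{true} \mid \mathtt{false} \mid \lambda x.c \mid \mathtt{rec}\;x = v$; computations $c ::= \mathtt{return}\;v \mid \mathit{op}\;v \mid v_1\,v_2 \mid \mathtt{if}\;v\;\mathtt{then}\;c_1\;\mathtt{else}\;c_2 \mid \mathtt{let}\;x = c_1\;\mathtt{in}\;c_2 \mid \mathtt{with}\;h\;\mathtt{handle}\;c$; handlers $h ::= \{\mathtt{return}\;x = c,\ \mathit{op}_1\,x_1\,k_1 = c_1, \dots, \mathit{op}_n\,x_n\,k_n = c_n\}$. Evaluation contexts: $E ::= [\,] \mid \mathtt{let}\;x = E\;\mathtt{in}\;c$. Semantics: $\to$ is the least relation such that: if $c_1\to c_2$ then $\mathtt{let}\;x=c_1\;\mathtt{in}\;c \to \mathtt{let}\;x=c_2\;\mathtt{in}\;c$; $\mathtt{let}\;x=\mathtt{return}\;v\;\mathtt{in}\;c \to c[v/x]$; $(\lambda x.c)\,v \to c[v/x]$; $(\mathtt{rec}\;x=v)\,v' \to v[(\mathtt{rec}\;x=v)/x]\,v'$; $\mathtt{if}\;\mathtt{true}\;\mathtt{then}\;c_1\;\mathtt{else}\;c_2 \to c_1$; $\mathtt{if}\;\mathtt{false}\;\mathtt{then}\;c_1\;\mathtt{else}\;c_2 \to c_2$; if $c\to c'$ then $\mathtt{with}\;h\;\mathtt{handle}\;c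 \to \mathtt{with}\;h\;\mathtt{handle}\;c'$; $\mathtt{with}\;h\;\mathtt{handle}\;\mathtt{return}\;v \to c[v/x]$ where $\mathtt{return}\;x=c$ is the return clause of $h$; $\mathtt{with}\;h\;\mathtt{handle}\;E[\mathit{op}\;v] \to c[v/x, (\lambda y.\mathtt{with}\;h\;\mathtt{handle}\;E[\mathtt{return}\;y])/k]$ where $\mathit{op}\;x\;k = c$ is a clause of $h$. ATM types: $b ::= \mathtt{unit} \mid \mathtt{bool}$; $\tau ::= b \mid \tau \to \rho$; $\rho ::= \tau/\square \mid \tau/\rho_1 \Rightarrow \rho_2$. The ATM signature $\Sigma$ assigns each operation a type $\tau\to\tau'/\rho_1\Rightarrow\rho_2$. Subtyping $\le$: $b \le b$; $\tau_1\to\rho_1 \le \tau_2\to\rho_2$ if $\tau_2\le\tau_1$, $\rho_1\le\rho_2$; $\tau_1/\square \le \tau_2/\square$ if $\tau_1\le\tau_2$; $\tau_1/\rho_1\Rightarrow\rho_1' \le \tau_2/\rho_2\Rightarrow\rho_2'$ if $\tau_1\le\tau_2$, $\rho_2\le\rho_1$, $\rho_1'\le\rho_2'$; $\tau_1/\square \le \tau_2/\rho_1\Rightarrow\rho_2$ if $\tau_1\le\tau_2$, $\rho_1\le\rho_2$. Typing $\vdash_{\mathrm{atm}}$: $\Gamma\vdash ():\mathtt{unit}$; $\Gamma\vdash\mathtt{true},\mathtt{false}:\mathtt{bool}$; $\Gamma\vdash x:\tau$ if $x:\tau\in\Gamma$; $\Gamma\vdash\lambda x.c:\tau\to\rho$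 if $\Gamma,x:\tau\vdash c:\rho$; $\Gamma\vdash\mathtt{rec}\;x=v:\tau$ if $\Gamma,x:\tau\vdash v:\tau$; $\Gamma\vdash\mathtt{if}\;v\;\mathtt{then}\;c_1\;\mathtt{else}\;c_2:\rho$ if $\Gamma\vdash v:\mathtt{bool}$, $\Gamma\vdash c_1:\rho$, $\Gamma\vdash c_2:\rho$; $\Gamma\vdash v_1\,v_2:\rho$ if $\Gamma\vdash v_1:\tau\to\rho$, $\Gamma\vdash v_2:\tau$; $\Gamma\vdash\mathtt{let}\;x=c_1\;\mathtt{in}\;c_2:\tau_2/\square$ if $\Gamma\vdash c_1:\tau_1/\square$, $\Gamma,x:\tau_1\vdash c_2:\tau_2/\square$; $\Gamma\vdash\mathtt{let}\;x=c_1\;\mathtt{in}\;c_2:\tau_2/\rho_2\Rightarrow\rho_1'$ if $\Gamma\vdash c_1:\tau_1/\rho_1\Rightarrow\rho_1'$, $\Gamma,x:\tau_1\vdash c_2:\tau_2/\rho_2\Rightarrow\rho_1$; $\Gamma\vdash\mathtt{return}\;v:\tau/\square$ if $\Gamma\vdash v:\tau$; $\Gamma\vdash\mathit{op}\;v:\tau'/\rho_1\Rightarrow\rho_2$ if $\Sigma(\mathit{op})=\tau\to\tau'/\rho_1\Rightarrow\rho_2$, $\Gamma\vdash v:\tau$; $\Gamma\vdash\{\mathtt{return}\;x=c,\overline{\mathit{op}_i\,x_i\,k_i=c_i}\}$ if for each $i$, $\Sigma(\mathit{op}_i)=\tau_i\to\tau_i'/\rho_i\Rightarrow\rho_i'$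 and $\Gamma,x_i:\tau_i,k_i:\tau_i'\to\rho_i\vdash c_i:\rho_i'$; $\Gamma\vdash\mathtt{with}\;h\;\mathtt{handle}\;c:\rho'$ if $\Gamma\vdash h$, $\Gamma\vdash c:\tau/\rho\Rightarrow\rho'$, $\Gamma,x:\tau\vdash c':\rho$ for the return clause $\mathtt{return}\;x=c'$ of $h$; $\Gamma\vdash v:\tau'$ if $\Gamma\vdash v:\tau$, $\tau\le\tau'$; $\Gamma\vdash c:\rho'$ if $\Gamma\vdash c:\rho$, $\rho\le\rho'$. -}

module Defs where

open import Data.Nat using (ℕ; zero; suc)
open import Data.Fin using (Fin; zero; suc)
open import Data.Vec using (Vec; _∷_; lookup)

data BaseTy : Set where
  unitᵗ boolᵗ : BaseTy

infixr 5 _⇒_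
infix 6 _/□ _/_⟹_

mutual
  data Ty : Set where
    base : BaseTy → Ty
    _⇒_  : Ty → ATy → Ty
  data ATy : Set where
    _/□    : Ty → ATy
    _/_⟹_ : Ty → ATy → ATy → ATy

-- Σ(op) = dom → cod / ansIn ⇒ ansOut
record OpSig : Set where
  constructor _↦_/_⟹_
  field
    dom cod : Ty
    ansIn ansOut : ATy
open OpSig public

Sig : Set → Set
Sig Op = Op → OpSig

infix 4 _≤ᵗ_ _≤ᵃ_

mutual
  data _≤ᵗ_ : Ty → Ty → Set where
    ≤-base : ∀ {b} → base b ≤ᵗ base b
    ≤-fun  : ∀ {τ₁ τ₂ ρ₁ ρ₂} → τ₂ ≤ᵗ τ₁ → ρ₁ ≤ᵃ ρ₂ → (τ₁ ⇒ ρ₁) ≤ᵗ (τ₂ ⇒ ρ₂)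
  data _≤ᵃ_ : ATy → ATy → Set where
    ≤-pure : ∀ {τ₁ τ₂} → τ₁ ≤ᵗ τ₂ → (τ₁ /□) ≤ᵃ (τ₂ /□)
    ≤-ans  : ∀ {τ₁ τ₂ ρ₁ ρ₁' ρ₂ ρ₂'} → τ₁ ≤ᵗ τ₂ → ρ₂ ≤ᵃ ρ₁ → ρ₁' ≤ᵃ ρ₂' →
             (τ₁ / ρ₁ ⟹ ρ₁') ≤ᵃ (τ₂ / ρ₂ ⟹ ρ₂')
    ≤-emb  : ∀ {τ₁ τ₂ ρ₁ ρ₂} → τ₁ ≤ᵗ τ₂ → ρ₁ ≤ᵃ ρ₂ → (τ₁ /□) ≤ᵃ (τ₂ / ρ₁ ⟹ ρ₂)

-- Syntax (well-scoped de Bruijn terms; Fin n = variables in scope)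

mutual
  data Val (Op : Set) (n : ℕ) : Set where
    var    : Fin n → Val Op n
    vunit  : Val Op n
    vtrue  : Val Op n
    vfalse : Val Op n
    lam    : Comp Op (suc n) → Val Op n
    rec    : Val Op (suc n) → Val Op n

  data Comp (Op : Set) (n : ℕ) : Set where
    ret    : Val Op n → Comp Op n
    perform : Op → Val Op n → Comp Op n
    app    : Val Op n → Val Op n → Comp Op n
    ite    : Val Op n → Comp Op n → Comp Op n → Comp Op n
    lett   : Comp Op n → Comp Op (suc n) → Comp Op n
    handle : Handler Op n → Comp Op n → Comp Op n

  data Handler (Op : Set) (n : ℕ) : Set where
    handler : Comp Op (suc n) → Clauses Op n → Handler Op n

  -- op x k = c : body scope extends by x then k (var zero = k, var (suc zero) = x)
  data Clauses (Op : Set) (n : ℕ) : Set where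
    []     : Clauses Op n
    clause : Op → Comp Op (suc (suc n)) → Clauses Op n → Clauses Op n

data ClauseIn {Op : Set} {n : ℕ} (o : Op) (c : Comp Op (suc (suc n))) : Clauses Op n → Set where
  here  : ∀ {cs} → ClauseIn o c (clause o c cs)
  there : ∀ {o' c' cs} → ClauseIn o c cs → ClauseIn o c (clause o' c' cs)

Ren : ℕ → ℕ → Set
Ren n m = Fin n → Fin m

ext : ∀ {n m} → Ren n m → Ren (suc n) (suc m)
ext r zero    = zero
ext r (suc i) = suc (r i)

mutual
  renV : ∀ {Op n m} → Ren n m → Val Op n → Val Op m
  renV r (var i) = var (r i)
  renV r vunit   = vunit
  renV r vtrue   = vtrue
  renV r vfalse  = vfalse
  renV r (lam c) = lam (renC (ext r) c)
  renV r (rec v) = rec (renV (ext r) v)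

  renC : ∀ {Op n m} → Ren n m → Comp Op n → Comp Op m
  renC r (ret v)         = ret (renV r v)
  renC r (perform o v)   = perform o (renV r v)
  renC r (app v w)       = app (renV r v) (renV r w)
  renC r (ite v c₁ c₂)   = ite (renV r v) (renC r c₁) (renC r c₂)
  renC r (lett c₁ c₂)    = lett (renC r c₁) (renC (ext r) c₂)
  renC r (handle h c)    = handle (renH r h) (renC r c)

  renH : ∀ {Op n m} → Ren n m → Handler Op n → Handler Op m
  renH r (handler c cs) = handler (renC (ext r) c) (renCl r cs)

  renCl : ∀ {Op n m} → Ren n m → Clauses Op n → Clauses Op m
  renCl r []               = []
  renCl r (clause o c cs)  = clause o (renC (ext (ext r)) c) (renCl r cs)

Sub : Set → ℕ → ℕ → Set
Sub Op n m = Fin n → Val Op m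

exts : ∀ {Op n m} → Sub Op n m → Sub Op (suc n) (suc m)
exts σ zero    = var zero
exts σ (suc i) = renV suc (σ i)

mutual
  subV : ∀ {Op n m} → Sub Op n m → Val Op n → Val Op m
  subV σ (var i) = σ i
  subV σ vunit   = vunit
  subV σ vtrue   = vtrue
  subV σ vfalse  = vfalse
  subV σ (lam c) = lam (subC (exts σ) c)
  subV σ (rec v) = rec (subV (exts σ) v)

  subC : ∀ {Op n m} → Sub Op n m → Comp Op n → Comp Op m
  subC σ (ret v)         = ret (subV σ v)
  subC σ (perform o v)   = perform o (subV σ v)
  subC σ (app v w)       = app (subV σ v) (subV σ w)
  subC σ (ite v c₁ c₂)   = ite (subV σ v) (subC σ c₁) (subC σ c₂)
  subC σ (lett c₁ c₂)    = lett (subC σ c₁) (subC (exts σ) c₂)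
  subC σ (handle h c)    = handle (subH σ h) (subC σ c)

  subH : ∀ {Op n m} → Sub Op n m → Handler Op n → Handler Op m
  subH σ (handler c cs) = handler (subC (exts σ) c) (subCl σ cs)

  subCl : ∀ {Op n m} → Sub Op n m → Clauses Op n → Clauses Op m
  subCl σ []              = []
  subCl σ (clause o c cs) = clause o (subC (exts (exts σ)) c) (subCl σ cs)

sub1 : ∀ {Op n} → Val Op n → Sub Op (suc n) n
sub1 v zero    = v
sub1 v (suc i) = var i

_[_]ᶜ : ∀ {Op n} → Comp Op (suc n) → Val Op n → Comp Op n
c [ v ]ᶜ = subC (sub1 v) c

_[_]ᵛ : ∀ {Op n} → Val Op (suc n) → Val Op n → Val Op n
w [ v ]ᵛ = subV (sub1 v) w

-- double substitution  c[v/x, w/k]  where k = var zero, x = var (suc zero)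
sub2 : ∀ {Op n} → Val Op n → Val Op n → Sub Op (suc (suc n)) n
sub2 v w zero          = w
sub2 v w (suc zero)    = v
sub2 v w (suc (suc i)) = var i

data ECtx (Op : Set) (n : ℕ) : Set where
  hole : ECtx Op n
  letE : ECtx Op n → Comp Op (suc n) → ECtx Op n

plug : ∀ {Op n} → ECtx Op n → Comp Op n → Comp Op n
plug hole       c = c
plug (letE E c') c = lett (plug E c) c'

renE : ∀ {Op n m} → Ren n m → ECtx Op n → ECtx Op m
renE r hole        = hole
renE r (letE E c)  = letE (renE r E) (renC (ext r) c)

cont : ∀ {Op n} → Handler Op n → ECtx Op n → Val Op n
cont h E = lam (handle (renH suc h) (plug (renE suc E) (ret (var zero))))

infix 3 _⟶_

data _⟶_ {Op : Set} {n : ℕ} : Comp Op n → Comp Op n → Set where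
  ξ-let     : ∀ {c₁ c₂ c} → c₁ ⟶ c₂ → lett c₁ c ⟶ lett c₂ c
  β-let     : ∀ {v c} → lett (ret v) c ⟶ c [ v ]ᶜ
  β-lam     : ∀ {c v} → app (lam c) v ⟶ c [ v ]ᶜ
  β-rec     : ∀ {v v'} → app (rec v) v' ⟶ app (v [ rec v ]ᵛ) v'
  β-true    : ∀ {c₁ c₂} → ite vtrue c₁ c₂ ⟶ c₁
  β-false   : ∀ {c₁ c₂} → ite vfalse c₁ c₂ ⟶ c₂
  ξ-handle  : ∀ {h c c'} → c ⟶ c' → handle h c ⟶ handle h c'
  β-ret     : ∀ {cr cs v} → handle (handler cr cs) (ret v) ⟶ cr [ v ]ᶜ
  β-op      : ∀ {cr cs E o v c} → ClauseIn o c cs →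
              handle (handler cr cs) (plug E (perform o v))
                ⟶ subC (sub2 v (cont (handler cr cs) E)) c

infix 3 _∣_⊢v_∶_ _∣_⊢c_∶_ _∣_⊢h_ _∣_⊢cl_

mutual
  data _∣_⊢v_∶_ {Op : Set} (Σ : Sig Op) : ∀ {n} → Vec Ty n → Val Op n → Ty → Set where
    t-unit  : ∀ {n} {Γ : Vec Ty n} → Σ ∣ Γ ⊢v vunit ∶ base unitᵗ
    t-true  : ∀ {n} {Γ : Vec Ty n} → Σ ∣ Γ ⊢v vtrue ∶ base boolᵗ
    t-false : ∀ {n} {Γ : Vec Ty n} → Σ ∣ Γ ⊢v vfalse ∶ base boolᵗ
    t-var   : ∀ {n} {Γ : Vec Ty n} (i : Fin n) → Σ ∣ Γ ⊢v var i ∶ lookup Γ i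
    t-lam   : ∀ {n} {Γ : Vec Ty n} {τ ρ c} →
              Σ ∣ τ ∷ Γ ⊢c c ∶ ρ → Σ ∣ Γ ⊢v lam c ∶ τ ⇒ ρ
    t-rec   : ∀ {n} {Γ : Vec Ty n} {τ v} →
              Σ ∣ τ ∷ Γ ⊢v v ∶ τ → Σ ∣ Γ ⊢v rec v ∶ τ
    t-subV  : ∀ {n} {Γ : Vec Ty n} {τ τ' v} →
              Σ ∣ Γ ⊢v v ∶ τ → τ ≤ᵗ τ' → Σ ∣ Γ ⊢v v ∶ τ'

  data _∣_⊢c_∶_ {Op : Set} (Σ : Sig Op) : ∀ {n} → Vec Ty n → Comp Op n → ATy → Set where
    t-if    : ∀ {n} {Γ : Vec Ty n} {ρ v c₁ c₂} →
              Σ ∣ Γ ⊢v v ∶ base boolᵗ → Σ ∣ Γ ⊢c c₁ ∶ ρ → Σ ∣ Γ ⊢c c₂ ∶ ρ →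
              Σ ∣ Γ ⊢c ite v c₁ c₂ ∶ ρ
    t-app   : ∀ {n} {Γ : Vec Ty n} {τ ρ v₁ v₂} →
              Σ ∣ Γ ⊢v v₁ ∶ τ ⇒ ρ → Σ ∣ Γ ⊢v v₂ ∶ τ → Σ ∣ Γ ⊢c app v₁ v₂ ∶ ρ
    t-let□  : ∀ {n} {Γ : Vec Ty n} {τ₁ τ₂ c₁ c₂} →
              Σ ∣ Γ ⊢c c₁ ∶ τ₁ /□ → Σ ∣ τ₁ ∷ Γ ⊢c c₂ ∶ τ₂ /□ →
              Σ ∣ Γ ⊢c lett c₁ c₂ ∶ τ₂ /□
    t-let   : ∀ {n} {Γ : Vec Ty n} {τ₁ τ₂ ρ₁ ρ₁' ρ₂ c₁ c₂} →
              Σ ∣ Γ ⊢c c₁ ∶ τ₁ / ρ₁ ⟹ ρ₁' → Σ ∣ τ₁ ∷ Γ ⊢c c₂ ∶ τ₂ / ρ₂ ⟹ ρ₁ →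
              Σ ∣ Γ ⊢c lett c₁ c₂ ∶ τ₂ / ρ₂ ⟹ ρ₁'
    t-ret   : ∀ {n} {Γ : Vec Ty n} {τ v} →
              Σ ∣ Γ ⊢v v ∶ τ → Σ ∣ Γ ⊢c ret v ∶ τ /□
    t-op    : ∀ {n} {Γ : Vec Ty n} {o v} →
              Σ ∣ Γ ⊢v v ∶ dom (Σ o) →
              Σ ∣ Γ ⊢c perform o v ∶ cod (Σ o) / ansIn (Σ o) ⟹ ansOut (Σ o)
    t-handle : ∀ {n} {Γ : Vec Ty n} {τ ρ ρ' cr cs c} →
              Σ ∣ Γ ⊢h handler cr cs → Σ ∣ Γ ⊢c c ∶ τ / ρ ⟹ ρ' →
              Σ ∣ τ ∷ Γ ⊢c cr ∶ ρ →
              Σ ∣ Γ ⊢c handle (handler cr cs) c ∶ ρ'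
    t-subC  : ∀ {n} {Γ : Vec Ty n} {ρ ρ' c} →
              Σ ∣ Γ ⊢c c ∶ ρ → ρ ≤ᵃ ρ' → Σ ∣ Γ ⊢c c ∶ ρ'

  -- Γ ⊢ h : every operation clause is well typed (return clause checked in t-handle)
  data _∣_⊢h_ {Op : Set} (Σ : Sig Op) : ∀ {n} → Vec Ty n → Handler Op n → Set where
    t-handler : ∀ {n} {Γ : Vec Ty n} {cr cs} → Σ ∣ Γ ⊢cl cs → Σ ∣ Γ ⊢h handler cr cs

  data _∣_⊢cl_ {Op : Set} (Σ : Sig Op) : ∀ {n} → Vec Ty n → Clauses Op n → Set where
    t-nil  : ∀ {n} {Γ : Vec Ty n} → Σ ∣ Γ ⊢cl []
    t-cons : ∀ {n} {Γ : Vec Ty n} {o c cs} →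
             Σ ∣ (cod (Σ o) ⇒ ansIn (Σ o)) ∷ dom (Σ o) ∷ Γ ⊢c c ∶ ansOut (Σ o) →
             Σ ∣ Γ ⊢cl cs → Σ ∣ Γ ⊢cl clause o c cs

-- The only real
-- work is the handled operation: a derivation of E[op v] ∶ τ / ρ₁ ⟹ ρ₂ splits into
-- v ∶ dom, ansOut ≤ ρ₂, and a derivation of E[return y] ∶ τ / ρ₁ ⟹ ansIn for a fresh
-- y ∶ cod, which is exactly what types the captured continuation λy. with h handle
-- E[return y] at cod ⇒ ansIn, the type the clause body expects for k.
module Submission where

open import Defs
open import Data.Nat using (ℕ)
open import Data.Fin using (zero; suc)
open import Data.Vec using (Vec; _∷_; lookup)
open import Data.Product using (∃; ∃₂; _,_; _×_)
open import Relation.Binary.PropositionalEquality using (_≡_; refl; subst)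

mutual
  ≤ᵗ-refl : ∀ τ → τ ≤ᵗ τ
  ≤ᵗ-refl (base b) = ≤-base
  ≤ᵗ-refl (τ ⇒ ρ)  = ≤-fun (≤ᵗ-refl τ) (≤ᵃ-refl ρ)

  ≤ᵃ-refl : ∀ ρ → ρ ≤ᵃ ρ
  ≤ᵃ-refl (τ /□)       = ≤-pure (≤ᵗ-refl τ)
  ≤ᵃ-refl (τ / ρ ⟹ ρ') = ≤-ans (≤ᵗ-refl τ) (≤ᵃ-refl ρ) (≤ᵃ-refl ρ')

mutual
  ≤ᵗ-trans : ∀ {τ₁ τ₂ τ₃} → τ₁ ≤ᵗ τ₂ → τ₂ ≤ᵗ τ₃ → τ₁ ≤ᵗ τ₃
  ≤ᵗ-trans ≤-base        ≤-base        = ≤-base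
  ≤ᵗ-trans (≤-fun p₁ q₁) (≤-fun p₂ q₂) = ≤-fun (≤ᵗ-trans p₂ p₁) (≤ᵃ-trans q₁ q₂)

  ≤ᵃ-trans : ∀ {ρ₁ ρ₂ ρ₃} → ρ₁ ≤ᵃ ρ₂ → ρ₂ ≤ᵃ ρ₃ → ρ₁ ≤ᵃ ρ₃
  ≤ᵃ-trans (≤-pure p)       (≤-pure q)       = ≤-pure (≤ᵗ-trans p q)
  ≤ᵃ-trans (≤-pure p)       (≤-emb q r)      = ≤-emb (≤ᵗ-trans p q) r
  ≤ᵃ-trans (≤-emb p r)      (≤-ans q s t)    = ≤-emb (≤ᵗ-trans p q) (≤ᵃ-trans s (≤ᵃ-trans r t))
  ≤ᵃ-trans (≤-ans p₁ q₁ r₁) (≤-ans p₂ q₂ r₂) =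
    ≤-ans (≤ᵗ-trans p₁ p₂) (≤ᵃ-trans q₂ q₁) (≤ᵃ-trans r₁ r₂)

infix 4 _∶_⇒ʳ_

-- A record rather than a Π-type, so that the contexts can be inferred from it.
record _∶_⇒ʳ_ {n m} (r : Ren n m) (Γ : Vec Ty n) (Δ : Vec Ty m) : Set where
  field lookup-ren : ∀ i → lookup Δ (r i) ≡ lookup Γ i
open _∶_⇒ʳ_

⇒ʳ-ext : ∀ {n m} {Γ : Vec Ty n} {Δ : Vec Ty m} {r τ} →
         r ∶ Γ ⇒ʳ Δ → ext r ∶ τ ∷ Γ ⇒ʳ τ ∷ Δ
⇒ʳ-ext r⇒ .lookup-ren zero    = refl
⇒ʳ-ext r⇒ .lookup-ren (suc i) = lookup-ren r⇒ i

⇒ʳ-wk : ∀ {n} {Γ : Vec Ty n} {τ} → suc ∶ Γ ⇒ʳ τ ∷ Γ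
⇒ʳ-wk .lookup-ren i = refl

module _ {Op : Set} (Σ : Sig Op) where

  mutual
    ⊢v-ren : ∀ {n m} {Γ : Vec Ty n} {Δ : Vec Ty m} {r v τ} →
             r ∶ Γ ⇒ʳ Δ → Σ ∣ Γ ⊢v v ∶ τ → Σ ∣ Δ ⊢v renV r v ∶ τ
    ⊢v-ren r⇒ t-unit      = t-unit
    ⊢v-ren r⇒ t-true      = t-true
    ⊢v-ren r⇒ t-false     = t-false
    ⊢v-ren {Δ = Δ} {r} r⇒ (t-var i) = subst (Σ ∣ Δ ⊢v var (r i) ∶_) (lookup-ren r⇒ i) (t-var (r i))
    ⊢v-ren r⇒ (t-lam d)   = t-lam (⊢c-ren (⇒ʳ-ext r⇒) d)
    ⊢v-ren r⇒ (t-rec d)   = t-rec (⊢v-ren (⇒ʳ-ext r⇒) d)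
    ⊢v-ren r⇒ (t-subV d s) = t-subV (⊢v-ren r⇒ d) s

    ⊢c-ren : ∀ {n m} {Γ : Vec Ty n} {Δ : Vec Ty m} {r c ρ} →
             r ∶ Γ ⇒ʳ Δ → Σ ∣ Γ ⊢c c ∶ ρ → Σ ∣ Δ ⊢c renC r c ∶ ρ
    ⊢c-ren r⇒ (t-if d d₁ d₂)   = t-if (⊢v-ren r⇒ d) (⊢c-ren r⇒ d₁) (⊢c-ren r⇒ d₂)
    ⊢c-ren r⇒ (t-app d₁ d₂)    = t-app (⊢v-ren r⇒ d₁) (⊢v-ren r⇒ d₂)
    ⊢c-ren r⇒ (t-let□ d₁ d₂)   = t-let□ (⊢c-ren r⇒ d₁) (⊢c-ren (⇒ʳ-ext r⇒) d₂)
    ⊢c-ren r⇒ (t-let d₁ d₂)    = t-let (⊢c-ren r⇒ d₁) (⊢c-ren (⇒ʳ-ext r⇒) d₂)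
    ⊢c-ren r⇒ (t-ret d)        = t-ret (⊢v-ren r⇒ d)
    ⊢c-ren r⇒ (t-op d)         = t-op (⊢v-ren r⇒ d)
    ⊢c-ren r⇒ (t-handle h d r) = t-handle (⊢h-ren r⇒ h) (⊢c-ren r⇒ d) (⊢c-ren (⇒ʳ-ext r⇒) r)
    ⊢c-ren r⇒ (t-subC d s)     = t-subC (⊢c-ren r⇒ d) s

    ⊢h-ren : ∀ {n m} {Γ : Vec Ty n} {Δ : Vec Ty m} {r h} →
             r ∶ Γ ⇒ʳ Δ → Σ ∣ Γ ⊢h h → Σ ∣ Δ ⊢h renH r h
    ⊢h-ren r⇒ (t-handler cl) = t-handler (⊢cl-ren r⇒ cl)

    ⊢cl-ren : ∀ {n m} {Γ : Vec Ty n} {Δ : Vec Ty m} {r cs} →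
              r ∶ Γ ⇒ʳ Δ → Σ ∣ Γ ⊢cl cs → Σ ∣ Δ ⊢cl renCl r cs
    ⊢cl-ren r⇒ t-nil         = t-nil
    ⊢cl-ren r⇒ (t-cons d cl) = t-cons (⊢c-ren (⇒ʳ-ext (⇒ʳ-ext r⇒)) d) (⊢cl-ren r⇒ cl)

  infix 4 _∶_⇒ˢ_

  _∶_⇒ˢ_ : ∀ {n m} → Sub Op n m → Vec Ty n → Vec Ty m → Set
  σ ∶ Γ ⇒ˢ Δ = ∀ i → Σ ∣ Δ ⊢v σ i ∶ lookup Γ i

  ⇒ˢ-exts : ∀ {n m} {Γ : Vec Ty n} {Δ : Vec Ty m} {σ τ} →
            σ ∶ Γ ⇒ˢ Δ → exts σ ∶ τ ∷ Γ ⇒ˢ τ ∷ Δ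
  ⇒ˢ-exts σ⇒ zero    = t-var zero
  ⇒ˢ-exts σ⇒ (suc i) = ⊢v-ren ⇒ʳ-wk (σ⇒ i)

  ⇒ˢ-sub1 : ∀ {n} {Γ : Vec Ty n} {v τ} → Σ ∣ Γ ⊢v v ∶ τ → sub1 v ∶ τ ∷ Γ ⇒ˢ Γ
  ⇒ˢ-sub1 d zero    = d
  ⇒ˢ-sub1 d (suc i) = t-var i

  ⇒ˢ-sub2 : ∀ {n} {Γ : Vec Ty n} {v w τ τ'} →
            Σ ∣ Γ ⊢v v ∶ τ → Σ ∣ Γ ⊢v w ∶ τ' → sub2 v w ∶ τ' ∷ τ ∷ Γ ⇒ˢ Γ
  ⇒ˢ-sub2 d e zero          = e
  ⇒ˢ-sub2 d e (suc zero)    = d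
  ⇒ˢ-sub2 d e (suc (suc i)) = t-var i

  mutual
    ⊢v-sub : ∀ {n m} {Γ : Vec Ty n} {Δ : Vec Ty m} {σ v τ} →
             σ ∶ Γ ⇒ˢ Δ → Σ ∣ Γ ⊢v v ∶ τ → Σ ∣ Δ ⊢v subV σ v ∶ τ
    ⊢v-sub σ⇒ t-unit       = t-unit
    ⊢v-sub σ⇒ t-true       = t-true
    ⊢v-sub σ⇒ t-false      = t-false
    ⊢v-sub σ⇒ (t-var i)    = σ⇒ i
    ⊢v-sub σ⇒ (t-lam d)    = t-lam (⊢c-sub (⇒ˢ-exts σ⇒) d)
    ⊢v-sub σ⇒ (t-rec d)    = t-rec (⊢v-sub (⇒ˢ-exts σ⇒) d)
    ⊢v-sub σ⇒ (t-subV d s) = t-subV (⊢v-sub σ⇒ d) s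

    ⊢c-sub : ∀ {n m} {Γ : Vec Ty n} {Δ : Vec Ty m} {σ c ρ} →
             σ ∶ Γ ⇒ˢ Δ → Σ ∣ Γ ⊢c c ∶ ρ → Σ ∣ Δ ⊢c subC σ c ∶ ρ
    ⊢c-sub σ⇒ (t-if d d₁ d₂)   = t-if (⊢v-sub σ⇒ d) (⊢c-sub σ⇒ d₁) (⊢c-sub σ⇒ d₂)
    ⊢c-sub σ⇒ (t-app d₁ d₂)    = t-app (⊢v-sub σ⇒ d₁) (⊢v-sub σ⇒ d₂)
    ⊢c-sub σ⇒ (t-let□ d₁ d₂)   = t-let□ (⊢c-sub σ⇒ d₁) (⊢c-sub (⇒ˢ-exts σ⇒) d₂)
    ⊢c-sub σ⇒ (t-let d₁ d₂)    = t-let (⊢c-sub σ⇒ d₁) (⊢c-sub (⇒ˢ-exts σ⇒) d₂)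
    ⊢c-sub σ⇒ (t-ret d)        = t-ret (⊢v-sub σ⇒ d)
    ⊢c-sub σ⇒ (t-op d)         = t-op (⊢v-sub σ⇒ d)
    ⊢c-sub σ⇒ (t-handle h d r) = t-handle (⊢h-sub σ⇒ h) (⊢c-sub σ⇒ d) (⊢c-sub (⇒ˢ-exts σ⇒) r)
    ⊢c-sub σ⇒ (t-subC d s)     = t-subC (⊢c-sub σ⇒ d) s

    ⊢h-sub : ∀ {n m} {Γ : Vec Ty n} {Δ : Vec Ty m} {σ h} →
             σ ∶ Γ ⇒ˢ Δ → Σ ∣ Γ ⊢h h → Σ ∣ Δ ⊢h subH σ h
    ⊢h-sub σ⇒ (t-handler cl) = t-handler (⊢cl-sub σ⇒ cl)

    ⊢cl-sub : ∀ {n m} {Γ : Vec Ty n} {Δ : Vec Ty m} {σ cs} →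
              σ ∶ Γ ⇒ˢ Δ → Σ ∣ Γ ⊢cl cs → Σ ∣ Δ ⊢cl subCl σ cs
    ⊢cl-sub σ⇒ t-nil         = t-nil
    ⊢cl-sub σ⇒ (t-cons d cl) = t-cons (⊢c-sub (⇒ˢ-exts (⇒ˢ-exts σ⇒)) d) (⊢cl-sub σ⇒ cl)

  ⊢c-[] : ∀ {n} {Γ : Vec Ty n} {c v τ ρ} →
          Σ ∣ τ ∷ Γ ⊢c c ∶ ρ → Σ ∣ Γ ⊢v v ∶ τ → Σ ∣ Γ ⊢c c [ v ]ᶜ ∶ ρ
  ⊢c-[] d e = ⊢c-sub (⇒ˢ-sub1 e) d

  ⊢v-[] : ∀ {n} {Γ : Vec Ty n} {w v τ τ'} →
          Σ ∣ τ ∷ Γ ⊢v w ∶ τ' → Σ ∣ Γ ⊢v v ∶ τ → Σ ∣ Γ ⊢v w [ v ]ᵛ ∶ τ'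
  ⊢v-[] d e = ⊢v-sub (⇒ˢ-sub1 e) d

  ⊢ret-inv : ∀ {n} {Γ : Vec Ty n} {v ρ} → Σ ∣ Γ ⊢c ret v ∶ ρ →
             ∃ λ τ → Σ ∣ Γ ⊢v v ∶ τ × τ /□ ≤ᵃ ρ
  ⊢ret-inv (t-ret {τ = τ} d) = τ , d , ≤ᵃ-refl (τ /□)
  ⊢ret-inv (t-subC d s) with ⊢ret-inv d
  ... | τ , e , s' = τ , e , ≤ᵃ-trans s' s

  ⊢lam-inv : ∀ {n} {Γ : Vec Ty n} {c T} → Σ ∣ Γ ⊢v lam c ∶ T →
             ∃₂ λ τ ρ → Σ ∣ τ ∷ Γ ⊢c c ∶ ρ × τ ⇒ ρ ≤ᵗ T
  ⊢lam-inv (t-lam {τ = τ} {ρ} d) = τ , ρ , d , ≤ᵗ-refl (τ ⇒ ρ)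
  ⊢lam-inv (t-subV d s) with ⊢lam-inv d
  ... | τ , ρ , e , s' = τ , ρ , e , ≤ᵗ-trans s' s

  ⊢rec-inv : ∀ {n} {Γ : Vec Ty n} {v T} → Σ ∣ Γ ⊢v rec v ∶ T →
             ∃ λ τ → Σ ∣ τ ∷ Γ ⊢v v ∶ τ × τ ≤ᵗ T
  ⊢rec-inv (t-rec {τ = τ} d) = τ , d , ≤ᵗ-refl τ
  ⊢rec-inv (t-subV d s) with ⊢rec-inv d
  ... | τ , e , s' = τ , e , ≤ᵗ-trans s' s

  ⊢cl-lookup : ∀ {n} {Γ : Vec Ty n} {o c cs} → ClauseIn o c cs → Σ ∣ Γ ⊢cl cs →
               Σ ∣ (cod (Σ o) ⇒ ansIn (Σ o)) ∷ dom (Σ o) ∷ Γ ⊢c c ∶ ansOut (Σ o)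
  ⊢cl-lookup here      (t-cons d _)  = d
  ⊢cl-lookup (there p) (t-cons _ cl) = ⊢cl-lookup p cl

  data PerformInv {n} (Γ : Vec Ty n) (E : ECtx Op n) (o : Op) (v : Val Op n) : ATy → Set where
    perform-inv : ∀ {τ ρ₁ ρ₂} →
                  Σ ∣ Γ ⊢v v ∶ dom (Σ o) → ansOut (Σ o) ≤ᵃ ρ₂ →
                  Σ ∣ cod (Σ o) ∷ Γ ⊢c plug (renE suc E) (ret (var zero)) ∶ τ / ρ₁ ⟹ ansIn (Σ o) →
                  PerformInv Γ E o v (τ / ρ₁ ⟹ ρ₂)

  PerformInv-≤ : ∀ {n} {Γ : Vec Ty n} {E o v ρ ρ'} →
                 PerformInv Γ E o v ρ → ρ ≤ᵃ ρ' → PerformInv Γ E o v ρ'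
  PerformInv-≤ (perform-inv d s k) (≤-ans p q r) =
    perform-inv d (≤ᵃ-trans s r) (t-subC k (≤-ans p q (≤ᵃ-refl _)))

  ⊢plug-perform-inv : ∀ {n} {Γ : Vec Ty n} (E : ECtx Op n) {o v ρ} →
                      Σ ∣ Γ ⊢c plug E (perform o v) ∶ ρ → PerformInv Γ E o v ρ
  ⊢plug-perform-inv hole       (t-subC d s) = PerformInv-≤ (⊢plug-perform-inv hole d) s
  ⊢plug-perform-inv (letE E c) (t-subC d s) = PerformInv-≤ (⊢plug-perform-inv (letE E c) d) s
  ⊢plug-perform-inv hole {o} (t-op d) =
    perform-inv d (≤ᵃ-refl _) (t-subC (t-ret (t-var zero)) (≤-emb (≤ᵗ-refl _) (≤ᵃ-refl (ansIn (Σ o)))))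
  ⊢plug-perform-inv (letE E c) (t-let□ d e) with ⊢plug-perform-inv E d
  ... | ()  -- a computation that performs an operation has no pure type
  ⊢plug-perform-inv (letE E c) (t-let d e) with ⊢plug-perform-inv E d
  ... | perform-inv a s k = perform-inv a s (t-let k (⊢c-ren (⇒ʳ-ext ⇒ʳ-wk) e))

  ⊢cont : ∀ {n} {Γ : Vec Ty n} {cr cs E τ' τ ρ ρ'} →
          Σ ∣ Γ ⊢h handler cr cs → Σ ∣ τ ∷ Γ ⊢c cr ∶ ρ →
          Σ ∣ τ' ∷ Γ ⊢c plug (renE suc E) (ret (var zero)) ∶ τ / ρ ⟹ ρ' →
          Σ ∣ Γ ⊢v cont (handler cr cs) E ∶ τ' ⇒ ρ'
  ⊢cont h r k = t-lam (t-handle (⊢h-ren ⇒ʳ-wk h) k (⊢c-ren (⇒ʳ-ext ⇒ʳ-wk) r))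

  preservation : ∀ {n} {Γ : Vec Ty n} {c c' ρ} → Σ ∣ Γ ⊢c c ∶ ρ → c ⟶ c' → Σ ∣ Γ ⊢c c' ∶ ρ
  preservation (t-subC d s) st = t-subC (preservation d st) s
  preservation (t-if _ d₁ d₂) β-true  = d₁
  preservation (t-if _ d₁ d₂) β-false = d₂
  preservation (t-app d e) β-lam with ⊢lam-inv d
  ... | _ , _ , body , ≤-fun p q = t-subC (⊢c-[] body (t-subV e p)) q
  preservation (t-app d e) β-rec with ⊢rec-inv d
  ... | _ , body , s = t-app (t-subV (⊢v-[] body (t-rec body)) s) e
  preservation (t-let□ d₁ d₂) (ξ-let st) = t-let□ (preservation d₁ st) d₂
  preservation (t-let d₁ d₂)  (ξ-let st) = t-let (preservation d₁ st) d₂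
  preservation (t-let□ d₁ d₂) β-let with ⊢ret-inv d₁
  ... | _ , e , ≤-pure p = ⊢c-[] d₂ (t-subV e p)
  preservation (t-let d₁ d₂) β-let with ⊢ret-inv d₁
  ... | _ , e , ≤-emb p q = t-subC (⊢c-[] d₂ (t-subV e p)) (≤-ans (≤ᵗ-refl _) (≤ᵃ-refl _) q)
  preservation (t-handle h d r) (ξ-handle st) = t-handle h (preservation d st) r
  preservation (t-handle h d r) β-ret with ⊢ret-inv d
  ... | _ , e , ≤-emb p q = t-subC (⊢c-[] r (t-subV e p)) q
  preservation (t-handle h@(t-handler cl) d r) (β-op {E = E} ci) with ⊢plug-perform-inv E d
  ... | perform-inv e s k = t-subC (⊢c-sub (⇒ˢ-sub2 e (⊢cont h r k)) (⊢cl-lookup ci cl)) s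

lemma4 : {Op : Set} (Σ : Sig Op) {n : ℕ} {Γ : Vec Ty n} {c c' : Comp Op n} {ρ : ATy} →
         Σ ∣ Γ ⊢c c ∶ ρ → c ⟶ c' → Σ ∣ Γ ⊢c c' ∶ ρ
lemma4 = preservation
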